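{- Let $p$ be prime. Suppose $G$ is an $n$-vertex graph with a $2$-packing $S=\{v_1,\ldots,v_l\}$. Let $H=K_{n+p-1}$ and $f:E(H)\to\mathbb{Z}_p$. If $H$ contains a family of pairwise disjoint switches $\{(S_i,T_i)\}_{i=1}^{l}$ (with respect to $f$) such that $|T_i|=\deg(v_i)$ for all $i$ and $\sum_{i=1}^{l}|S_i|=p+l-1$, then $H$ contains a copy $G'$ of $G$ with $\sum_{e\in E(G')}f(e)=0$.
   Context: For a vertex $u$, $N[u]=N(u)\cup\{u\}$. A $2$-packing of a graph $G$ is a set $S\subseteq V(G)$ such that $N[u]\cap N[v]=\emptyset$ for all distinct $u,v\in S$. Let $H$ be a complete graph and $f:E(H)\to\mathbb{Z}_p$. A pair $(S,T)$ is a switch if $S,T\subseteq V(H)$, $|S|\geq 2$, $|T|\geq 1$, $S\cap T=\emptyset$, and $\left|\{\sum_{t\in T}f(st):s\in S\}\right|=|S|$ (i.e., the stars with center in $S$ and leaf set $T$ have pairwise distinct edge sums). Switches $(S_1,T_1)$ and $(S_2,T_2)$ are disjoint if $S_1,S_2,T_1,T_2$ are pairwise disjoint; a family is pairwise disjoint if every two of its members are disjoint. -}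

module Defs where

open import Data.Nat using (ℕ; zero; suc; _+_; _%_; NonZero)
open import Data.Fin using (Fin; toℕ)
open import Data.Fin.Subset using (Subset; _∈_; ∣_∣)
open import Data.Vec using (lookup)
open import Data.List using (List; map; allFin)
open import Data.Nat.ListAction using (sum)
open import Data.Empty using (⊥)
open import Data.Bool using (Bool; true; false; if_then_else_)
open import Data.Product using (_×_)
open import Data.Sum using (_⊎_)
open import Relation.Binary.PropositionalEquality using (_≡_; _≢_)
open import Relation.Nullary using (¬_)

Σ[<_]_ : (n : ℕ) → (Fin n → ℕ) → ℕ
Σ[< n ] g = sum (map g (allFin n))

record Graph (n : ℕ) : Set where
  field
    adj   : Fin n → Fin n → Bool
    sym   : ∀ u v → adj u v ≡ adj v u
    irrefl : ∀ u → adj u u ≡ false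
open Graph public

deg : ∀ {n} → Graph n → Fin n → ℕ
deg {n} G u = Σ[< n ] (λ v → if adj G u v then 1 else 0)

_∈N[_]_ : ∀ {n} → Fin n → Fin n → Graph n → Set
w ∈N[ u ] G = (w ≡ u) ⊎ (adj G u w ≡ true)

Is2Packing : ∀ {n l} → Graph n → (Fin l → Fin n) → Set
Is2Packing {n} {l} G v =
  (∀ i j → v i ≡ v j → i ≡ j) ×
  (∀ i j → i ≢ j → ∀ (w : Fin n) → ¬ ((w ∈N[ v i ] G) × (w ∈N[ v j ] G)))

-- edge labelling of the complete graph K_m with values in Z_p
-- (f u v is the label of the edge uv; diagonal values are irrelevant)
Labelling : ℕ → ℕ → Set
Labelling m p = Fin m → Fin m → Fin p

Symmetric : ∀ {m p} → Labelling m p → Set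
Symmetric f = ∀ u v → f u v ≡ f v u

Disjoint : ∀ {m} → Subset m → Subset m → Set
Disjoint A B = ∀ x → x ∈ A → x ∈ B → ⊥

starSum : ∀ {m p} .{{_ : NonZero p}} → Labelling m p → Fin m → Subset m → ℕ
starSum {m} {p} f s T = (Σ[< m ] (λ t → if lookup T t then toℕ (f s t) else 0)) % p

IsSwitch : ∀ {m p} .{{_ : NonZero p}} → Labelling m p → Subset m → Subset m → Set
IsSwitch f S T =
  (2 Data.Nat.≤ ∣ S ∣) × (1 Data.Nat.≤ ∣ T ∣) × Disjoint S T ×
  (∀ s s' → s ∈ S → s' ∈ S → s ≢ s' → starSum f s T ≢ starSum f s' T)

DisjointSwitches : ∀ {m} → Subset m → Subset m → Subset m → Subset m → Set
DisjointSwitches S₁ T₁ S₂ T₂ =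
  Disjoint S₁ T₁ × Disjoint S₁ S₂ × Disjoint S₁ T₂ ×
  Disjoint T₁ S₂ × Disjoint T₁ T₂ × Disjoint S₂ T₂

-- edge sum (mod p) of the copy of G given by the injection φ : V(G) → V(K_m);
-- each edge {u,v} counted once (u < v)
copySum : ∀ {n m p} .{{_ : NonZero p}} → Graph n → Labelling m p → (Fin n → Fin m) → ℕ
copySum {n} {m} {p} G f φ =
  (Σ[< n ] (λ u → Σ[< n ] (λ v →
     if adj G u v then (if toℕ u Data.Nat.<ᵇ toℕ v then toℕ (f (φ u) (φ v)) else 0) else 0))) % p

module Submission where

open import Algebra.Bundles using (CommutativeMonoid)
open import Data.Bool using (Bool; true; false; if_then_else_; _∧_; _∨_; not)
open import Data.Bool.Properties
  using (∧-commutativeMonoid; ¬-not; ∧-zeroʳ; ∧-identityʳ; ∧-conicalˡ; ∧-conicalʳ) renaming (_≟_ to _≟ᵇ_)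
open import Algebra.Properties.CommutativeSemigroup (CommutativeMonoid.commutativeSemigroup ∧-commutativeMonoid)
  using (xy∙z≈xz∙y)
open import Data.Empty using (⊥; ⊥-elim)
open import Data.Fin using (Fin; zero; suc; toℕ; punchIn)
open import Data.Fin.Permutation using (permutation)
open import Data.Fin.Properties using (any?; punchInᵢ≢i; toℕ-injective; toℕ-fromℕ<; toℕ<n) renaming (_≟_ to _≟ᶠ_)
import Data.Fin.Properties as Fin
open import Data.Fin.Subset using (Subset; ∣_∣)
open import Data.List using (tabulate)
open import Data.List.Properties using (map-tabulate)
open import Data.Nat
open import Data.Nat.Coprimality using (prime⇒coprime; coprime-Bézout)
open import Data.Nat.DivMod
open import Data.Nat.GCD using (module Bézout)
import Data.Nat.ListAction as List
open import Data.Nat.Primality using (Prime)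
open import Data.Nat.Properties
open import Data.Nat.Tactic.RingSolver using (solve-∀)
open import Data.Product using (Σ; ∃; ∃₂; _×_; _,_; proj₁; proj₂)
open import Data.Sum using (_⊎_; inj₁; inj₂)
open import Data.Vec as Vec using (lookup)
open import Data.Vec.Functional using (_∷_)
open import Data.Vec.Properties using (lookup⇒[]=)
open import Function using (_∘_; id; const; case_of_)
open import Relation.Binary.Definitions using (DecidableEquality)
open import Relation.Binary.PropositionalEquality hiding ([_])
open import Relation.Nullary using (Dec; yes; no; does; ¬_)
open import Relation.Nullary.Decidable using (dec-true; dec-false; map′; decidable-stable)

open import Algebra.Properties.Semiring.Sum +-*-semiring
  using (sum; sum-cong-≗; sum-replicate-zero; sum-remove; ∑-distrib-+; ∑-comm; sum-permute)

open import Defs hiding (sym)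

-- Map the neighbours of each centre vᵢ onto Tᵢ and the remaining non-centres onto the vertices
-- of H outside all switches (there is room, and one colour-preserving injection does it); each
-- centre vᵢ may then be placed on any sᵢ ∈ Sᵢ.  As S is a 2-packing, every edge of G meets at
-- most one centre, so the weight of such a copy is a constant C₀ plus the star sums σᵢ(sᵢ) of the
-- stars (sᵢ, Tᵢ).  By the switch property σᵢ takes |Sᵢ| distinct values on Sᵢ, so by the
-- Cauchy–Davenport theorem (proved with Dyson's e-transform) the sums σ₁(s₁) + ⋯ + σₗ(sₗ) take at
-- least min(p, Σ|Sᵢ| − l + 1) = p values; one of them is −C₀.

private
  variable
    n : ℕ

-- Finite sums and counting

sum-tabulate : (g : Fin n → ℕ) → List.sum (tabulate g) ≡ sum g
sum-tabulate {zero}  g = refl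
sum-tabulate {suc n} g = cong (g zero +_) (sum-tabulate (g ∘ suc))

Σ[<]≡sum : (g : Fin n → ℕ) → Σ[< n ] g ≡ sum g
Σ[<]≡sum g = trans (cong List.sum (map-tabulate id g)) (sum-tabulate g)

sum-mono-≤ : {f g : Fin n → ℕ} → (∀ i → f i ≤ g i) → sum f ≤ sum g
sum-mono-≤ {zero}  f≤g = z≤n
sum-mono-≤ {suc n} f≤g = +-mono-≤ (f≤g zero) (sum-mono-≤ (f≤g ∘ suc))

sum-zero : {f : Fin n → ℕ} → (∀ i → f i ≡ 0) → sum f ≡ 0
sum-zero {n} f≡0 = trans (sum-cong-≗ f≡0) (sum-replicate-zero n)

sum-single : (j : Fin n) {f : Fin n → ℕ} → (∀ i → i ≢ j → f i ≡ 0) → sum f ≡ f j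
sum-single {suc n} j {f} f≡0 = begin
  sum f                       ≡⟨ sum-remove f ⟩
  f j + sum (f ∘ punchIn j)   ≡⟨ cong (f j +_) (sum-zero (λ i → f≡0 (punchIn j i) (punchInᵢ≢i j i))) ⟩
  f j + 0                     ≡⟨ +-identityʳ (f j) ⟩
  f j                         ∎
  where open ≡-Reasoning

sum-if : (b : Bool) (h : Fin n → ℕ) → sum (λ i → if b then h i else 0) ≡ (if b then sum h else 0)
sum-if     true  h = refl
sum-if {n} false h = sum-zero {n} (λ _ → refl)

sum-∸1 : {f : Fin n → ℕ} → (∀ i → 1 ≤ f i) → sum (λ i → f i ∸ 1) + n ≡ sum f
sum-∸1 {n} {f} 1≤f = begin
  sum (λ i → f i ∸ 1) + n                  ≡⟨ cong (sum (λ i → f i ∸ 1) +_) (sum-ones n) ⟨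
  sum (λ i → f i ∸ 1) + sum {n} (const 1)  ≡⟨ ∑-distrib-+ (λ i → f i ∸ 1) (const 1) ⟨
  sum (λ i → f i ∸ 1 + 1)                  ≡⟨ sum-cong-≗ (λ i → m∸n+n≡m (1≤f i)) ⟩
  sum f                                    ∎
  where
  open ≡-Reasoning
  sum-ones : ∀ n → sum {n} (const 1) ≡ n
  sum-ones zero    = refl
  sum-ones (suc n) = cong suc (sum-ones n)

does-true : {A : Set} (a? : Dec A) → does a? ≡ true → A
does-true (yes a) _ = a

does-≡ : {A : Set} {b : Bool} (a? : Dec A) → (A → b ≡ true) → (b ≡ true → A) → does a? ≡ b
does-≡ (yes a) a⇒b _   = sym (a⇒b a)
does-≡ (no ¬a) _   b⇒a = sym (¬-not (¬a ∘ b⇒a))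

infix  4 _⊆_
infixr 7 _∩_
infixr 6 _∪_

_⊆_ : (P Q : Fin n → Bool) → Set
P ⊆ Q = ∀ i → P i ≡ true → Q i ≡ true

_∪_ _∩_ : (P Q : Fin n → Bool) → Fin n → Bool
(P ∪ Q) i = P i ∨ Q i
(P ∩ Q) i = P i ∧ Q i

∁ : (Fin n → Bool) → Fin n → Bool
∁ P i = not (P i)

⁅_⁆ : Fin n → Fin n → Bool
⁅ j ⁆ i = does (i ≟ᶠ j)

⁅⁆-elim : {i j : Fin n} → ⁅ j ⁆ i ≡ true → i ≡ j
⁅⁆-elim {i = i} {j} = does-true (i ≟ᶠ j)

∃ᵇ : (Fin n → Bool) → Bool
∃ᵇ P = does (any? (λ i → P i ≟ᵇ true))

∃ᵇ-intro : (P : Fin n → Bool) {i : Fin n} → P i ≡ true → ∃ᵇ P ≡ true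
∃ᵇ-intro P {i} Pi = dec-true (any? (λ i → P i ≟ᵇ true)) (i , Pi)

∃ᵇ-elim : (P : Fin n → Bool) → ∃ᵇ P ≡ true → ∃ λ i → P i ≡ true
∃ᵇ-elim P = does-true (any? (λ i → P i ≟ᵇ true))

sumWhere : (Fin n → Bool) → (Fin n → ℕ) → ℕ
sumWhere P h = sum (λ i → if P i then h i else 0)

𝟙 : Bool → ℕ
𝟙 b = if b then 1 else 0

count : (Fin n → Bool) → ℕ
count P = sum (𝟙 ∘ P)

sumWhere-cong : {P Q : Fin n → Bool} → (∀ i → P i ≡ Q i) → (h : Fin n → ℕ) → sumWhere P h ≡ sumWhere Q h
sumWhere-cong P≡Q h = sum-cong-≗ (λ i → cong (λ b → if b then h i else 0) (P≡Q i))

sumWhere-none : {P : Fin n → Bool} → (∀ i → P i ≡ false) → (h : Fin n → ℕ) → sumWhere P h ≡ 0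
sumWhere-none P≡false h = sum-zero (λ i → cong (λ b → if b then h i else 0) (P≡false i))

sumWhere-split : (P Q : Fin n → Bool) (h : Fin n → ℕ) →
                 sumWhere P h ≡ sumWhere (P ∩ Q) h + sumWhere (P ∩ ∁ Q) h
sumWhere-split P Q h = trans (sum-cong-≗ (λ i → split (P i) (Q i) (h i)))
                             (∑-distrib-+ (λ i → if (P ∩ Q) i then h i else 0) (λ i → if (P ∩ ∁ Q) i then h i else 0))
  where
  split : ∀ b c x → (if b then x else 0) ≡ (if b ∧ c then x else 0) + (if b ∧ not c then x else 0)
  split true  true  x = sym (+-identityʳ x)
  split true  false x = refl
  split false c     x = refl

sumWhere-∩⁅⁆ : (P : Fin n → Bool) (j : Fin n) (h : Fin n → ℕ) →
               sumWhere (P ∩ ⁅ j ⁆) h ≡ (if P j then h j else 0)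
sumWhere-∩⁅⁆ P j h = trans (sum-single j (λ i i≢j → cong (λ b → if b then h i else 0) (off-j i i≢j)))
                            (cong (λ b → if b then h j else 0) at-j)
  where
  off-j : ∀ i → i ≢ j → P i ∧ ⁅ j ⁆ i ≡ false
  off-j i i≢j = trans (cong (P i ∧_) (dec-false (i ≟ᶠ j) i≢j)) (∧-zeroʳ (P i))
  at-j : P j ∧ ⁅ j ⁆ j ≡ P j
  at-j = trans (cong (P j ∧_) (dec-true (j ≟ᶠ j) refl)) (∧-identityʳ (P j))

sumWhere-pick : (P : Fin n → Bool) (j : Fin n) (h : Fin n → ℕ) →
                sumWhere P h ≡ (if P j then h j else 0) + sumWhere (P ∩ ∁ ⁅ j ⁆) h
sumWhere-pick P j h = trans (sumWhere-split P ⁅ j ⁆ h) (cong (_+ sumWhere (P ∩ ∁ ⁅ j ⁆) h) (sumWhere-∩⁅⁆ P j h))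

sumWhere-image : ∀ {l} (v : Fin l → Fin n) → (∀ {i j} → v i ≡ v j → i ≡ j) → {C : Fin n → Bool} →
                 (∀ {u} → C u ≡ true → ∃ λ i → v i ≡ u) → (∀ i → C (v i) ≡ true) →
                 (F : Fin n → ℕ) → sumWhere C F ≡ sum (F ∘ v)
sumWhere-image {n} {l} v v-injective {C} C⊆image image⊆C F = begin
  sumWhere C F                                          ≡⟨ sum-cong-≗ (λ u → split u (C u) refl) ⟩
  sum (λ u → sum (λ i → if ⁅ v i ⁆ u then F u else 0))  ≡⟨ ∑-comm (λ u i → if ⁅ v i ⁆ u then F u else 0) ⟩
  sum (λ i → sumWhere ⁅ v i ⁆ F)                        ≡⟨ sum-cong-≗ (λ i → sumWhere-∩⁅⁆ (const true) (v i) F) ⟩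
  sum (F ∘ v)                                           ∎
  where
  open ≡-Reasoning
  split : ∀ u b → C u ≡ b → (if b then F u else 0) ≡ sum (λ i → if ⁅ v i ⁆ u then F u else 0)
  split u true  Cu = let (i , vi≡u) = C⊆image Cu in sym (trans
    (sum-single i (λ j j≢i → cong (λ b → if b then F u else 0)
                               (dec-false (u ≟ᶠ v j) (λ u≡vj → j≢i (v-injective (trans (sym u≡vj) (sym vi≡u)))))))
    (cong (λ b → if b then F u else 0) (dec-true (u ≟ᶠ v i) (sym vi≡u))))
  split u false ¬Cu = sym (sumWhere-none {l} {λ i → ⁅ v i ⁆ u} (λ i → ¬-not (λ u∈⁅vi⁆ →
    case trans (sym (image⊆C i)) (trans (cong C (sym (⁅⁆-elim u∈⁅vi⁆))) ¬Cu) of λ ())) (const (F u)))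

count-pick-true : {P : Fin n → Bool} {j : Fin n} → P j ≡ true → count P ≡ suc (count (P ∩ ∁ ⁅ j ⁆))
count-pick-true {P = P} {j} Pj = trans (sumWhere-pick P j (const 1)) (cong (λ b → 𝟙 b + count (P ∩ ∁ ⁅ j ⁆)) Pj)

count-pick-false : {P : Fin n → Bool} {j : Fin n} → P j ≡ false → count P ≡ count (P ∩ ∁ ⁅ j ⁆)
count-pick-false {P = P} {j} ¬Pj = trans (sumWhere-pick P j (const 1)) (cong (λ b → 𝟙 b + count (P ∩ ∁ ⁅ j ⁆)) ¬Pj)

count-⁅⁆ : (j : Fin n) → count ⁅ j ⁆ ≡ 1
count-⁅⁆ j = sumWhere-∩⁅⁆ (const true) j (const 1)

count≤n : (P : Fin n → Bool) → count P ≤ n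
count≤n {zero}  P = z≤n
count≤n {suc n} P = +-mono-≤ (𝟙≤1 (P zero)) (count≤n (P ∘ suc))
  where
  𝟙≤1 : ∀ b → 𝟙 b ≤ 1
  𝟙≤1 true  = ≤-refl
  𝟙≤1 false = z≤n

count-mono : {P Q : Fin n → Bool} → P ⊆ Q → count P ≤ count Q
count-mono {P = P} {Q} P⊆Q = sum-mono-≤ (λ i → 𝟙-mono (P i) (Q i) (P⊆Q i))
  where
  𝟙-mono : ∀ b c → (b ≡ true → c ≡ true) → 𝟙 b ≤ 𝟙 c
  𝟙-mono true  c b⇒c rewrite b⇒c refl = ≤-refl
  𝟙-mono false c b⇒c = z≤n

count-none : {P : Fin n → Bool} → (∀ i → P i ≡ false) → count P ≡ 0
count-none P≡false = sumWhere-none P≡false (const 1)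

count-all : {P : Fin n → Bool} → (∀ i → P i ≡ true) → count P ≡ n
count-all {zero}  P≡true = refl
count-all {suc n} P≡true = cong₂ _+_ (cong 𝟙 (P≡true zero)) (count-all (P≡true ∘ suc))

count-single : {P : Fin n → Bool} (j : Fin n) → P j ≡ true → (∀ {i} → P i ≡ true → i ≡ j) → count P ≡ 1
count-single j Pj unique = trans (sum-single j (λ i i≢j → cong 𝟙 (¬-not (i≢j ∘ unique)))) (cong 𝟙 Pj)

count-pos : {P : Fin n → Bool} {i : Fin n} → P i ≡ true → 1 ≤ count P
count-pos {P = P} Pi = subst (1 ≤_) (sym (count-pick-true {P = P} Pi)) (s≤s z≤n)

count-zero : {P : Fin n → Bool} → count P ≡ 0 → ∀ i → P i ≡ false
count-zero {P = P} count≡0 i = ¬-not (λ Pi → <⇒≢ (count-pos {P = P} Pi) (sym count≡0))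

count-witness : {P : Fin n → Bool} → 1 ≤ count P → ∃ λ i → P i ≡ true
count-witness {P = P} 1≤count = decidable-stable (any? (λ i → P i ≟ᵇ true)) (λ none →
  <⇒≢ 1≤count (sym (count-none (λ i → ¬-not (λ Pi → none (i , Pi))))))

count-strict : {P Q : Fin n → Bool} (j : Fin n) → P ⊆ Q → Q j ≡ true → P j ≡ false → suc (count P) ≤ count Q
count-strict {P = P} {Q} j P⊆Q Qj ¬Pj = begin
  suc (count P)                           ≡⟨ cong suc (count-pick-false {P = P} ¬Pj) ⟩
  suc (count (P ∩ ∁ ⁅ j ⁆))               ≤⟨ s≤s (count-mono P∖j⊆Q∖j) ⟩
  suc (count (Q ∩ ∁ ⁅ j ⁆))               ≡⟨ count-pick-true {P = Q} Qj ⟨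
  count Q                                 ∎
  where
  open ≤-Reasoning
  P∖j⊆Q∖j : P ∩ ∁ ⁅ j ⁆ ⊆ Q ∩ ∁ ⁅ j ⁆
  P∖j⊆Q∖j i Pi∧i≢j = cong₂ _∧_ (P⊆Q i (∧-conicalˡ (P i) _ Pi∧i≢j)) (∧-conicalʳ (P i) _ Pi∧i≢j)

count-full : {P : Fin n → Bool} → n ≤ count P → ∀ i → P i ≡ true
count-full {n} {P} n≤count i = decidable-stable (P i ≟ᵇ true) (λ ¬Pi →
  <⇒≱ (≤-trans (count-strict i (λ _ _ → refl) refl (¬-not ¬Pi)) (count≤n (const true))) n≤count)

count-two : {P : Fin n → Bool} → 2 ≤ count P → ∃₂ λ i j → i ≢ j × P i ≡ true × P j ≡ true
count-two {P = P} 2≤count with count-witness (≤-trans (s≤s z≤n) 2≤count)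
... | i , Pi with count-witness {P = P ∩ ∁ ⁅ i ⁆}
                    (≤-pred (≤-trans 2≤count (≤-reflexive (count-pick-true {P = P} Pi))))
...   | j , Pj∧j≢i = i , j , i≢j , Pi , ∧-conicalˡ (P j) _ Pj∧j≢i
  where
  i≢j : i ≢ j
  i≢j refl = case trans (cong not (sym (dec-true (i ≟ᶠ i) refl))) (∧-conicalʳ (P i) _ Pj∧j≢i) of λ ()

count-∪+∩ : (P Q : Fin n → Bool) → count (P ∪ Q) + count (P ∩ Q) ≡ count P + count Q
count-∪+∩ P Q = begin
  count (P ∪ Q) + count (P ∩ Q)                ≡⟨ ∑-distrib-+ (𝟙 ∘ (P ∪ Q)) (𝟙 ∘ (P ∩ Q)) ⟨
  sum (λ i → 𝟙 (P i ∨ Q i) + 𝟙 (P i ∧ Q i))    ≡⟨ sum-cong-≗ (λ i → 𝟙-∨+∧ (P i) (Q i)) ⟩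
  sum (λ i → 𝟙 (P i) + 𝟙 (Q i))                ≡⟨ ∑-distrib-+ (𝟙 ∘ P) (𝟙 ∘ Q) ⟩
  count P + count Q                            ∎
  where
  open ≡-Reasoning
  𝟙-∨+∧ : ∀ b c → 𝟙 (b ∨ c) + 𝟙 (b ∧ c) ≡ 𝟙 b + 𝟙 c
  𝟙-∨+∧ true  true  = refl
  𝟙-∨+∧ true  false = refl
  𝟙-∨+∧ false true  = refl
  𝟙-∨+∧ false false = refl

count-permute : (P : Fin n → Bool) (π ρ : Fin n → Fin n) →
                (∀ i → π (ρ i) ≡ i) → (∀ i → ρ (π i) ≡ i) → count (P ∘ π) ≡ count P
count-permute P π ρ πρ ρπ = sym (sum-permute (𝟙 ∘ P) (permutation π ρ πρ ρπ))

count-lookup : ∀ {m} (X : Subset m) → count (lookup X) ≡ ∣ X ∣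
count-lookup Vec.[]          = refl
count-lookup (true Vec.∷ X)  = cong suc (count-lookup X)
count-lookup (false Vec.∷ X) = count-lookup X

image : ∀ {m} → (Fin m → Bool) → (Fin m → Fin n) → Fin n → Bool
image P a z = ∃ᵇ (P ∩ ⁅ z ⁆ ∘ a)

image-intro : ∀ {m} (P : Fin m → Bool) (a : Fin m → Fin n) {y} → P y ≡ true → image P a (a y) ≡ true
image-intro P a {y} Py = ∃ᵇ-intro (P ∩ ⁅ a y ⁆ ∘ a) (cong₂ _∧_ Py (dec-true (a y ≟ᶠ a y) refl))

image-elim : ∀ {m} (P : Fin m → Bool) (a : Fin m → Fin n) {z} → image P a z ≡ true →
             ∃ λ y → P y ≡ true × a y ≡ z
image-elim P a {z} z∈image = let (y , Py∧ay≡z) = ∃ᵇ-elim (P ∩ ⁅ z ⁆ ∘ a) z∈image in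
  y , ∧-conicalˡ (P y) _ Py∧ay≡z , ⁅⁆-elim (∧-conicalʳ (P y) _ Py∧ay≡z)

count-image : ∀ {m} (P : Fin m → Bool) (a : Fin m → Fin n) →
              (∀ {y y′} → P y ≡ true → P y′ ≡ true → a y ≡ a y′ → y ≡ y′) →
              count P ≤ count (image P a)
count-image {m = zero}  P a injective = z≤n
count-image {m = suc m} P a injective = split (P zero) refl
  where
  IH : count (P ∘ suc) ≤ count (image (P ∘ suc) (a ∘ suc))
  IH = count-image (P ∘ suc) (a ∘ suc) (λ Py Py′ → Fin.suc-injective ∘ injective Py Py′)
  image-suc⊆image : image (P ∘ suc) (a ∘ suc) ⊆ image P a
  image-suc⊆image z z∈ = let (y , Py , ay≡z) = image-elim (P ∘ suc) (a ∘ suc) z∈ in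
    subst (λ z → image P a z ≡ true) ay≡z (image-intro P a Py)
  split : ∀ b → P zero ≡ b → 𝟙 b + count (P ∘ suc) ≤ count (image P a)
  split false _  = ≤-trans IH (count-mono image-suc⊆image)
  split true  P0 = ≤-trans (s≤s IH) (count-strict (a zero) image-suc⊆image (image-intro P a P0) a0∉image-suc)
    where
    a0∉image-suc : image (P ∘ suc) (a ∘ suc) (a zero) ≡ false
    a0∉image-suc = ¬-not (λ a0∈ → let (y , Py , ay≡a0) = image-elim (P ∘ suc) (a ∘ suc) a0∈ in
                                  case injective Py P0 ay≡a0 of λ ())

⊓-absorbs-+ : ∀ m n o → m ⊓ (n + m ⊓ o) ≡ m ⊓ (n + o)
⊓-absorbs-+ m n o with ≤-total m o
... | inj₁ m≤o = begin
  m ⊓ (n + m ⊓ o)   ≡⟨ cong (λ k → m ⊓ (n + k)) (m≤n⇒m⊓n≡m m≤o) ⟩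
  m ⊓ (n + m)       ≡⟨ m≤n⇒m⊓n≡m (m≤n+m m n) ⟩
  m                 ≡⟨ m≤n⇒m⊓n≡m (m≤n⇒m≤o+n n m≤o) ⟨
  m ⊓ (n + o)       ∎
  where open ≡-Reasoning
... | inj₂ o≤m = cong (λ k → m ⊓ (n + k)) (m≥n⇒m⊓n≡n o≤m)

-- Arithmetic modulo p and the Cauchy–Davenport theorem

module Residues (p : ℕ) .{{_ : NonZero p}} where

  ℤₚ : Set
  ℤₚ = Fin p

  [_] : ℕ → ℤₚ
  [ m ] = m mod p

  infix  8 -_
  infixl 6 _⊕_ _⊖_

  _⊕_ : ℤₚ → ℤₚ → ℤₚ
  x ⊕ y = [ toℕ x + toℕ y ]

  -_ : ℤₚ → ℤₚ
  - y = [ p ∸ toℕ y ]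

  _⊖_ : ℤₚ → ℤₚ → ℤₚ
  x ⊖ y = x ⊕ (- y)

  toℕ-[] : ∀ m → toℕ [ m ] ≡ m % p
  toℕ-[] m = toℕ-fromℕ< (m%n<n m p)

  toℕ-[0] : toℕ [ 0 ] ≡ 0
  toℕ-[0] = trans (toℕ-[] 0) (m<n⇒m%n≡m (>-nonZero⁻¹ p))

  []-toℕ : ∀ x → [ toℕ x ] ≡ x
  []-toℕ x = toℕ-injective (trans (toℕ-[] (toℕ x)) (m<n⇒m%n≡m (toℕ<n x)))

  []-cong : ∀ {m n} → m % p ≡ n % p → [ m ] ≡ [ n ]
  []-cong {m} {n} eq = toℕ-injective (trans (toℕ-[] m) (trans eq (sym (toℕ-[] n))))

  []-% : ∀ m → [ m % p ] ≡ [ m ]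
  []-% m = []-cong (m%n%n≡m%n m p)

  []-+p : ∀ m → [ m + p ] ≡ [ m ]
  []-+p m = []-cong ([m+n]%n≡m%n m p)

  []-+ : ∀ m n → [ m + n ] ≡ [ m ] ⊕ [ n ]
  []-+ m n = []-cong (begin
    (m + n) % p                  ≡⟨ %-distribˡ-+ m n p ⟩
    (m % p + n % p) % p          ≡⟨ cong₂ (λ a b → (a + b) % p) (toℕ-[] m) (toℕ-[] n) ⟨
    (toℕ [ m ] + toℕ [ n ]) % p  ∎)
    where open ≡-Reasoning

  []-*ˡ : ∀ k {m n} → [ m ] ≡ [ n ] → [ k * m ] ≡ [ k * n ]
  []-*ˡ k {m} {n} [m]≡[n] = []-cong (begin
    (k * m) % p               ≡⟨ %-distribˡ-* k m p ⟩
    (k % p * (m % p)) % p     ≡⟨ cong (λ r → (k % p * r) % p) m%p≡n%p ⟩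
    (k % p * (n % p)) % p     ≡⟨ %-distribˡ-* k n p ⟨
    (k * n) % p               ∎)
    where
    open ≡-Reasoning
    m%p≡n%p : m % p ≡ n % p
    m%p≡n%p = trans (sym (toℕ-[] m)) (trans (cong toℕ [m]≡[n]) (toℕ-[] n))

  []-sum : ∀ {l} (f : Fin l → ℕ) → [ sum f ] ≡ [ sum (λ i → f i % p) ]
  []-sum {zero}  f = refl
  []-sum {suc l} f = begin
    [ f zero + sum (f ∘ suc) ]                       ≡⟨ []-+ (f zero) (sum (f ∘ suc)) ⟩
    [ f zero ] ⊕ [ sum (f ∘ suc) ]                   ≡⟨ cong₂ _⊕_ (sym ([]-% (f zero))) ([]-sum (f ∘ suc)) ⟩
    [ f zero % p ] ⊕ [ sum (λ i → f (suc i) % p) ]   ≡⟨ []-+ (f zero % p) _ ⟨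
    [ f zero % p + sum (λ i → f (suc i) % p) ]       ∎
    where open ≡-Reasoning

  %-sum : ∀ a {l} (f : Fin l → ℕ) → (a + sum f) % p ≡ (a + sum (λ i → f i % p)) % p
  %-sum a f = begin
    (a + sum f) % p                          ≡⟨ toℕ-[] (a + sum f) ⟨
    toℕ [ a + sum f ]                        ≡⟨ cong toℕ ([]-+ a (sum f)) ⟩
    toℕ ([ a ] ⊕ [ sum f ])                  ≡⟨ cong (λ x → toℕ ([ a ] ⊕ x)) ([]-sum f) ⟩
    toℕ ([ a ] ⊕ [ sum (λ i → f i % p) ])    ≡⟨ cong toℕ ([]-+ a _) ⟨
    toℕ [ a + sum (λ i → f i % p) ]          ≡⟨ toℕ-[] _ ⟩
    (a + sum (λ i → f i % p)) % p            ∎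
    where open ≡-Reasoning

  ⊕-comm : ∀ x y → x ⊕ y ≡ y ⊕ x
  ⊕-comm x y = cong [_] (+-comm (toℕ x) (toℕ y))

  ⊕-assoc : ∀ x y z → (x ⊕ y) ⊕ z ≡ x ⊕ (y ⊕ z)
  ⊕-assoc x y z = begin
    [ toℕ x + toℕ y ] ⊕ z            ≡⟨ cong ([ toℕ x + toℕ y ] ⊕_) ([]-toℕ z) ⟨
    [ toℕ x + toℕ y ] ⊕ [ toℕ z ]    ≡⟨ []-+ (toℕ x + toℕ y) (toℕ z) ⟨
    [ toℕ x + toℕ y + toℕ z ]        ≡⟨ cong [_] (+-assoc (toℕ x) (toℕ y) (toℕ z)) ⟩
    [ toℕ x + (toℕ y + toℕ z) ]      ≡⟨ []-+ (toℕ x) (toℕ y + toℕ z) ⟩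
    [ toℕ x ] ⊕ (y ⊕ z)              ≡⟨ cong (_⊕ (y ⊕ z)) ([]-toℕ x) ⟩
    x ⊕ (y ⊕ z)                      ∎
    where open ≡-Reasoning

  ⊕-identityʳ : ∀ x → x ⊕ [ 0 ] ≡ x
  ⊕-identityʳ x = begin
    x ⊕ [ 0 ]          ≡⟨ cong (_⊕ [ 0 ]) ([]-toℕ x) ⟨
    [ toℕ x ] ⊕ [ 0 ]  ≡⟨ []-+ (toℕ x) 0 ⟨
    [ toℕ x + 0 ]      ≡⟨ cong [_] (+-identityʳ (toℕ x)) ⟩
    [ toℕ x ]          ≡⟨ []-toℕ x ⟩
    x                  ∎
    where open ≡-Reasoning

  ⊕-identityˡ : ∀ x → [ 0 ] ⊕ x ≡ x
  ⊕-identityˡ x = trans (⊕-comm [ 0 ] x) (⊕-identityʳ x)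

  ⊕-inverseʳ : ∀ y → y ⊕ (- y) ≡ [ 0 ]
  ⊕-inverseʳ y = begin
    y ⊕ (- y)                    ≡⟨ cong (_⊕ (- y)) ([]-toℕ y) ⟨
    [ toℕ y ] ⊕ [ p ∸ toℕ y ]    ≡⟨ []-+ (toℕ y) (p ∸ toℕ y) ⟨
    [ toℕ y + (p ∸ toℕ y) ]      ≡⟨ cong [_] (m+[n∸m]≡n (<⇒≤ (toℕ<n y))) ⟩
    [ p ]                        ≡⟨ []-+p 0 ⟩
    [ 0 ]                        ∎
    where open ≡-Reasoning

  ⊕-⊖ : ∀ x y → (x ⊕ y) ⊖ y ≡ x
  ⊕-⊖ x y = trans (⊕-assoc x y (- y)) (trans (cong (x ⊕_) (⊕-inverseʳ y)) (⊕-identityʳ x))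

  ⊖-⊕ : ∀ x y → (x ⊖ y) ⊕ y ≡ x
  ⊖-⊕ x y = trans (⊕-assoc x (- y) y) (trans (cong (x ⊕_) (trans (⊕-comm (- y) y) (⊕-inverseʳ y))) (⊕-identityʳ x))

  ⊕-⊖-cancel : ∀ x y → x ⊕ (y ⊖ x) ≡ y
  ⊕-⊖-cancel x y = trans (⊕-comm x (y ⊖ x)) (⊖-⊕ y x)

  ⊕-cancelʳ : ∀ {x y} z → x ⊕ z ≡ y ⊕ z → x ≡ y
  ⊕-cancelʳ {x} {y} z eq = trans (sym (⊕-⊖ x z)) (trans (cong (_⊖ z) eq) (⊕-⊖ y z))

  ⊕-⊖-shift : ∀ x y z → y ⊕ (x ⊖ z) ≡ x ⊕ (y ⊖ z)
  ⊕-⊖-shift x y z = begin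
    y ⊕ (x ⊕ - z)     ≡⟨ ⊕-assoc y x (- z) ⟨
    (y ⊕ x) ⊕ - z     ≡⟨ cong (_⊕ - z) (⊕-comm y x) ⟩
    (x ⊕ y) ⊕ - z     ≡⟨ ⊕-assoc x y (- z) ⟩
    x ⊕ (y ⊕ - z)     ∎
    where open ≡-Reasoning

  ≢⇒⊖≢0 : ∀ {x y} → x ≢ y → y ⊖ x ≢ [ 0 ]
  ≢⇒⊖≢0 {x} {y} x≢y y⊖x≡0 = x≢y (begin
    x                 ≡⟨ ⊕-identityˡ x ⟨
    [ 0 ] ⊕ x         ≡⟨ cong (_⊕ x) y⊖x≡0 ⟨
    (y ⊖ x) ⊕ x       ≡⟨ ⊖-⊕ y x ⟩
    y                 ∎)
    where open ≡-Reasoning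

  module _ (p-prime : Prime p) where

    mul-inverse : ∀ d → d ≢ [ 0 ] → ∃ λ u → [ u * toℕ d ] ≡ [ 1 ]
    mul-inverse d d≢0 with coprime-Bézout (prime⇒coprime p-prime {{≢-nonZero toℕd≢0}} (toℕ<n d))
      where
      toℕd≢0 : toℕ d ≢ 0
      toℕd≢0 toℕd≡0 = d≢0 (trans (sym ([]-toℕ d)) (cong [_] toℕd≡0))
    ... | Bézout.-+ x y 1+xp≡yd = y , []-cong (trans (cong (_% p) (sym 1+xp≡yd)) ([m+kn]%n≡m%n 1 x p))
    ... | Bézout.+- x y 1+yd≡xp = (p ∸ 1) * y , ⊕-cancelʳ [ p ∸ 1 ] (begin
      [ (p ∸ 1) * y * toℕ d ] ⊕ [ p ∸ 1 ]     ≡⟨ []-+ ((p ∸ 1) * y * toℕ d) (p ∸ 1) ⟨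
      [ (p ∸ 1) * y * toℕ d + (p ∸ 1) ]       ≡⟨ cong [_] (distrib (p ∸ 1) y (toℕ d)) ⟩
      [ (p ∸ 1) * (1 + y * toℕ d) ]           ≡⟨ cong (λ m → [ (p ∸ 1) * m ]) 1+yd≡xp ⟩
      [ (p ∸ 1) * (x * p) ]                   ≡⟨ cong [_] (*-assoc (p ∸ 1) x p) ⟨
      [ 0 + (p ∸ 1) * x * p ]                 ≡⟨ []-cong ([m+kn]%n≡m%n 0 ((p ∸ 1) * x) p) ⟩
      [ 0 ]                                   ≡⟨ []-+p 0 ⟨
      [ p ]                                   ≡⟨ cong [_] (m+[n∸m]≡n (>-nonZero⁻¹ p)) ⟨
      [ 1 + (p ∸ 1) ]                         ≡⟨ []-+ 1 (p ∸ 1) ⟩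
      [ 1 ] ⊕ [ p ∸ 1 ]                       ∎)
      where
      open ≡-Reasoning
      distrib : ∀ q y d → q * y * d + q ≡ q * (1 + y * d)
      distrib = solve-∀

    progression-covers : ∀ a {d} z → d ≢ [ 0 ] → ∃ λ k → a ⊕ [ k * toℕ d ] ≡ z
    progression-covers a {d} z d≢0 = let (u , ud≡1) = mul-inverse d d≢0; t = toℕ (z ⊖ a) in
      t * u , (begin
        a ⊕ [ t * u * toℕ d ]     ≡⟨ cong (λ m → a ⊕ [ m ]) (*-assoc t u (toℕ d)) ⟩
        a ⊕ [ t * (u * toℕ d) ]   ≡⟨ cong (a ⊕_) ([]-*ˡ t ud≡1) ⟩
        a ⊕ [ t * 1 ]             ≡⟨ cong (λ m → a ⊕ [ m ]) (*-identityʳ t) ⟩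
        a ⊕ [ t ]                 ≡⟨ cong (a ⊕_) ([]-toℕ (z ⊖ a)) ⟩
        a ⊕ (z ⊖ a)               ≡⟨ ⊕-⊖-cancel a z ⟩
        z                         ∎)
      where open ≡-Reasoning

    boundary-step : (A : ℤₚ → Bool) {a z d : ℤₚ} → A a ≡ true → A z ≡ false → d ≢ [ 0 ] →
                    ∃ λ x → A x ≡ true × A (x ⊕ d) ≡ false
    boundary-step A {a} {z} {d} Aa ¬Az d≢0 = let (k , a+kd≡z) = progression-covers a z d≢0 in
      walk k (subst (λ x → A x ≡ false) (sym a+kd≡z) ¬Az)
      where
      next : ∀ k → a ⊕ [ suc k * toℕ d ] ≡ (a ⊕ [ k * toℕ d ]) ⊕ d
      next k = begin
        a ⊕ [ toℕ d + k * toℕ d ]       ≡⟨ cong (a ⊕_) ([]-+ (toℕ d) (k * toℕ d)) ⟩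
        a ⊕ ([ toℕ d ] ⊕ [ k * toℕ d ]) ≡⟨ cong (λ y → a ⊕ (y ⊕ [ k * toℕ d ])) ([]-toℕ d) ⟩
        a ⊕ (d ⊕ [ k * toℕ d ])         ≡⟨ cong (a ⊕_) (⊕-comm d [ k * toℕ d ]) ⟩
        a ⊕ ([ k * toℕ d ] ⊕ d)         ≡⟨ ⊕-assoc a [ k * toℕ d ] d ⟨
        (a ⊕ [ k * toℕ d ]) ⊕ d         ∎
        where open ≡-Reasoning
      walk : ∀ k → A (a ⊕ [ k * toℕ d ]) ≡ false → ∃ λ x → A x ≡ true × A (x ⊕ d) ≡ false
      walk zero    ¬A = case trans (sym Aa) (trans (cong A (sym (⊕-identityʳ a))) ¬A) of λ ()
      walk (suc k) ¬A with A (a ⊕ [ k * toℕ d ]) in Ak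
      ... | true  = a ⊕ [ k * toℕ d ] , Ak , subst (λ x → A x ≡ false) (next k) ¬A
      ... | false = walk k Ak

  infixl 6 _⊞_

  _⊞_ : (A B : ℤₚ → Bool) → ℤₚ → Bool
  (A ⊞ B) z = ∃ᵇ (λ x → A x ∧ B (z ⊖ x))

  ⊞-intro : ∀ {A B x y} → A x ≡ true → B y ≡ true → (A ⊞ B) (x ⊕ y) ≡ true
  ⊞-intro {A} {B} {x} {y} Ax By = ∃ᵇ-intro (λ x′ → A x′ ∧ B ((x ⊕ y) ⊖ x′)) {x}
    (cong₂ _∧_ Ax (trans (cong B (trans (cong (_⊖ x) (⊕-comm x y)) (⊕-⊖ y x))) By))

  ⊞-elim : ∀ {A B z} → (A ⊞ B) z ≡ true → ∃₂ λ x y → A x ≡ true × B y ≡ true × x ⊕ y ≡ z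
  ⊞-elim {A} {B} {z} z∈A⊞B = let (x , Ax∧B[z-x]) = ∃ᵇ-elim (λ x → A x ∧ B (z ⊖ x)) z∈A⊞B in
    x , z ⊖ x , ∧-conicalˡ (A x) _ Ax∧B[z-x] , ∧-conicalʳ (A x) _ Ax∧B[z-x] , ⊕-⊖-cancel x z

  count-translate : (A : ℤₚ → Bool) (e : ℤₚ) → count (λ x → A (x ⊖ e)) ≡ count A
  count-translate A e = count-permute A (_⊖ e) (_⊕ e) (λ x → ⊕-⊖ x e) (λ x → ⊖-⊕ x e)

  count-≤-⊞ : ∀ {A B b} → B b ≡ true → count A ≤ count (A ⊞ B)
  count-≤-⊞ {A} {B} {b} Bb = subst (_≤ count (A ⊞ B)) (count-translate A b)
    (count-mono (λ z A[z-b] → subst (λ z → (A ⊞ B) z ≡ true) (⊖-⊕ z b) (⊞-intro {A} {B} A[z-b] Bb)))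

  module DysonTransform (A B : ℤₚ → Bool) (e : ℤₚ) where

    A′ B′ : ℤₚ → Bool
    A′ = A ∪ (λ x → B (x ⊖ e))
    B′ = (λ y → A (y ⊕ e)) ∩ B

    A⊆A′ : A ⊆ A′
    A⊆A′ x Ax = cong (_∨ B (x ⊖ e)) Ax

    B′⊆B : B′ ⊆ B
    B′⊆B y = ∧-conicalʳ (A (y ⊕ e)) (B y)

    A′⊞B′⊆A⊞B : A′ ⊞ B′ ⊆ A ⊞ B
    A′⊞B′⊆A⊞B z z∈A′⊞B′ with ⊞-elim {A′} {B′} z∈A′⊞B′
    ... | x , y , A′x , B′y , x+y≡z with A x in Ax
    ...   | true  = subst (λ z → (A ⊞ B) z ≡ true) x+y≡z (⊞-intro {A} {B} Ax (B′⊆B y B′y))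
    ...   | false = subst (λ z → (A ⊞ B) z ≡ true) regroup
                      (⊞-intro {A} {B} (∧-conicalˡ (A (y ⊕ e)) (B y) B′y) A′x)
      where
      regroup : (y ⊕ e) ⊕ (x ⊖ e) ≡ z
      regroup = begin
        (y ⊕ e) ⊕ (x ⊖ e)    ≡⟨ ⊕-assoc y e (x ⊖ e) ⟩
        y ⊕ (e ⊕ (x ⊖ e))    ≡⟨ cong (y ⊕_) (⊕-⊖-cancel e x) ⟩
        y ⊕ x                ≡⟨ ⊕-comm y x ⟩
        x ⊕ y                ≡⟨ x+y≡z ⟩
        z                    ∎
        where open ≡-Reasoning

    count-A′+B′ : count A′ + count B′ ≡ count A + count B
    count-A′+B′ = begin
      count A′ + count B′            ≡⟨ cong (count A′ +_) B′-translate ⟨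
      count A′ + count (A ∩ B[-e])   ≡⟨ count-∪+∩ A B[-e] ⟩
      count A + count B[-e]          ≡⟨ cong (count A +_) (count-translate B e) ⟩
      count A + count B              ∎
      where
      open ≡-Reasoning
      B[-e] : ℤₚ → Bool
      B[-e] x = B (x ⊖ e)
      B′-translate : count (A ∩ B[-e]) ≡ count B′
      B′-translate = begin
        count (A ∩ B[-e])              ≡⟨ count-permute (A ∩ B[-e]) (_⊕ e) (_⊖ e) (λ x → ⊖-⊕ x e) (λ x → ⊕-⊖ x e) ⟨
        count ((A ∩ B[-e]) ∘ (_⊕ e))   ≡⟨ sum-cong-≗ (λ y → cong (λ x → 𝟙 (A (y ⊕ e) ∧ B x)) (⊕-⊖ y e)) ⟩
        count B′                       ∎

  cauchy-davenport : Prime p → ∀ {A B} → 1 ≤ count A → 1 ≤ count B →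
                     p ⊓ (count A + count B ∸ 1) ≤ count (A ⊞ B)
  cauchy-davenport p-prime {A} {B} = induction (count B) ≤-refl
    where
    induction : ∀ N {A B} → count B ≤ N → 1 ≤ count A → 1 ≤ count B →
                p ⊓ (count A + count B ∸ 1) ≤ count (A ⊞ B)
    induction zero    B≤0 _ 1≤B = ⊥-elim (<⇒≱ 1≤B B≤0)
    induction (suc N) {A} {B} B≤1+N 1≤A 1≤B = case count B ≤? 1 of λ where
        (yes B≤1) → ≤-trans (m⊓n≤n p _) (singleton B≤1)
        (no B≰1)  → case any? (λ z → A z ≟ᵇ false) of λ where
          (no A-full)     → ≤-trans (m⊓n≤m p _) (full A-full)
          (yes (z , ¬Az)) → transform (count-two (≰⇒> B≰1)) (count-witness 1≤A) ¬Az
      where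
      open ≤-Reasoning
      A≤A⊞B : count A ≤ count (A ⊞ B)
      A≤A⊞B = let (b , Bb) = count-witness {P = B} 1≤B in count-≤-⊞ {A} {B} Bb

      singleton : count B ≤ 1 → count A + count B ∸ 1 ≤ count (A ⊞ B)
      singleton B≤1 = begin
        count A + count B ∸ 1   ≤⟨ ∸-monoˡ-≤ {count A + count B} {count A + 1} 1 (+-monoʳ-≤ (count A) B≤1) ⟩
        count A + 1 ∸ 1         ≡⟨ m+n∸n≡m (count A) 1 ⟩
        count A                 ≤⟨ A≤A⊞B ⟩
        count (A ⊞ B)           ∎

      full : ¬ (∃ λ z → A z ≡ false) → p ≤ count (A ⊞ B)
      full A-full = subst (_≤ count (A ⊞ B)) (count-all (λ z → ¬-not (λ Az → A-full (z , Az)))) A≤A⊞B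

      -- x ∈ A with x + (b₂ − b₁) ∉ A exists as A ≠ ℤₚ; for e = x − b₁ the e-transform keeps
      -- b₁ in B′ but drops b₂, so the induction on |B| applies.
      transform : (∃₂ λ b₁ b₂ → b₁ ≢ b₂ × B b₁ ≡ true × B b₂ ≡ true) → (∃ λ a → A a ≡ true) →
                  ∀ {z} → A z ≡ false → p ⊓ (count A + count B ∸ 1) ≤ count (A ⊞ B)
      transform (b₁ , b₂ , b₁≢b₂ , Bb₁ , Bb₂) (a , Aa) ¬Az = begin
        p ⊓ (count A + count B ∸ 1)    ≡⟨ cong (λ m → p ⊓ (m ∸ 1)) count-A′+B′ ⟨
        p ⊓ (count A′ + count B′ ∸ 1)  ≤⟨ induction N B′≤N (≤-trans 1≤A (count-mono A⊆A′))
                                                       (count-pos {P = B′} B′b₁) ⟩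
        count (A′ ⊞ B′)                ≤⟨ count-mono A′⊞B′⊆A⊞B ⟩
        count (A ⊞ B)                  ∎
        where
        boundary = boundary-step p-prime A Aa ¬Az (≢⇒⊖≢0 b₁≢b₂)
        x = proj₁ boundary
        open DysonTransform A B (x ⊖ b₁)
        B′b₁ : B′ b₁ ≡ true
        B′b₁ = cong₂ _∧_ (trans (cong A (⊕-⊖-cancel b₁ x)) (proj₁ (proj₂ boundary))) Bb₁
        ¬B′b₂ : B′ b₂ ≡ false
        ¬B′b₂ = cong (_∧ B b₂) (trans (cong A (⊕-⊖-shift x b₂ b₁)) (proj₂ (proj₂ boundary)))
        B′≤N : count B′ ≤ N
        B′≤N = ≤-pred (≤-trans (count-strict b₂ B′⊆B Bb₂ ¬B′b₂) B≤1+N)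

  ⨁ : ∀ {l} → (Fin l → ℤₚ → Bool) → ℤₚ → Bool
  ⨁ {zero}  A = ⁅ [ 0 ] ⁆
  ⨁ {suc l} A = A zero ⊞ ⨁ (A ∘ suc)

  ⨁-elim : ∀ {l} (A : Fin l → ℤₚ → Bool) {z} → ⨁ A z ≡ true →
           ∃ λ c → (∀ i → A i (c i) ≡ true) × [ sum (toℕ ∘ c) ] ≡ z
  ⨁-elim {zero}  A z∈ = (λ ()) , (λ ()) , sym (⁅⁆-elim z∈)
  ⨁-elim {suc l} A z∈ with ⊞-elim {A zero} {⨁ (A ∘ suc)} z∈
  ... | x , y , A₀x , y∈ , x+y≡z with ⨁-elim (A ∘ suc) y∈
  ...   | c , c∈A , Σc≡y = x ∷ c , (λ { zero → A₀x ; (suc i) → c∈A i }) , (begin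
    [ toℕ x + sum (toℕ ∘ c) ]       ≡⟨ []-+ (toℕ x) (sum (toℕ ∘ c)) ⟩
    [ toℕ x ] ⊕ [ sum (toℕ ∘ c) ]   ≡⟨ cong₂ _⊕_ ([]-toℕ x) Σc≡y ⟩
    x ⊕ y                           ≡⟨ x+y≡z ⟩
    _                               ∎)
    where open ≡-Reasoning

  module _ (p-prime : Prime p) where

    ⨁-bound : ∀ {l} (A : Fin l → ℤₚ → Bool) → (∀ i → 1 ≤ count (A i)) →
              p ⊓ suc (sum (λ i → count (A i) ∸ 1)) ≤ count (⨁ A)
    ⨁-bound {zero}  A _ = ≤-trans (m⊓n≤n p 1) (≤-reflexive (sym (count-⁅⁆ [ 0 ])))
    ⨁-bound {suc l} A 1≤A = begin
      p ⊓ suc (a ∸ 1 + E)          ≡⟨ cong (p ⊓_) (+-suc (a ∸ 1) E) ⟨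
      p ⊓ (a ∸ 1 + suc E)          ≡⟨ ⊓-absorbs-+ p (a ∸ 1) (suc E) ⟨
      p ⊓ (a ∸ 1 + p ⊓ suc E)      ≤⟨ ⊓-monoʳ-≤ p (+-monoʳ-≤ (a ∸ 1) IH) ⟩
      p ⊓ (a ∸ 1 + r)              ≡⟨ cong (p ⊓_) (+-∸-comm r (1≤A zero)) ⟨
      p ⊓ (a + r ∸ 1)              ≤⟨ cauchy-davenport p-prime (1≤A zero) 1≤r ⟩
      count (A zero ⊞ ⨁ (A ∘ suc)) ∎
      where
      open ≤-Reasoning
      a = count (A zero)
      r = count (⨁ (A ∘ suc))
      E = sum (λ i → count (A (suc i)) ∸ 1)
      IH : p ⊓ suc E ≤ r
      IH = ⨁-bound (A ∘ suc) (1≤A ∘ suc)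
      1≤r : 1 ≤ r
      1≤r = ≤-trans (⊓-glb (>-nonZero⁻¹ p) (s≤s z≤n)) IH

    ⨁-full : ∀ {l} (A : Fin l → ℤₚ → Bool) → (∀ i → 1 ≤ count (A i)) →
             p ∸ 1 ≤ sum (λ i → count (A i) ∸ 1) → ∀ z → ⨁ A z ≡ true
    ⨁-full A 1≤A p-1≤E = count-full (begin
      p                                      ≡⟨ m≤n⇒m⊓n≡m (≤-trans (m≤n+m∸n p 1) (s≤s p-1≤E)) ⟨
      p ⊓ suc (sum (λ i → count (A i) ∸ 1))  ≤⟨ ⨁-bound A 1≤A ⟩
      count (⨁ A)                            ∎)
      where open ≤-Reasoning

-- Edge sums of a graph

<ᵇ-trichotomy : ∀ m n → m ≢ n → ((m <ᵇ n) ≡ true × (n <ᵇ m) ≡ false) ⊎ ((m <ᵇ n) ≡ false × (n <ᵇ m) ≡ true)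
<ᵇ-trichotomy zero    zero    m≢n = ⊥-elim (m≢n refl)
<ᵇ-trichotomy zero    (suc n) _   = inj₁ (refl , refl)
<ᵇ-trichotomy (suc m) zero    _   = inj₂ (refl , refl)
<ᵇ-trichotomy (suc m) (suc n) m≢n = <ᵇ-trichotomy m n (m≢n ∘ cong suc)

module _ (G : Graph n) where

  edgeTerm : (Fin n → Fin n → ℕ) → Fin n → Fin n → ℕ
  edgeTerm g u w = if adj G u w then (if toℕ u <ᵇ toℕ w then g u w else 0) else 0

  edgeSum : (Fin n → Fin n → ℕ) → ℕ
  edgeSum g = sum (λ u → sum (edgeTerm g u))

  copySum≡edgeSum : ∀ {m p} .{{_ : NonZero p}} (f : Labelling m p) (φ : Fin n → Fin m) →
                    copySum G f φ ≡ edgeSum (λ u w → toℕ (f (φ u) (φ w))) % p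
  copySum≡edgeSum {p = p} f φ = cong (_% p) (trans (Σ[<]≡sum (λ u → Σ[< n ] (edgeTerm g u)))
                                                   (sum-cong-≗ (λ u → Σ[<]≡sum (edgeTerm g u))))
    where
    g : Fin n → Fin n → ℕ
    g u w = toℕ (f (φ u) (φ w))

  edgeTerm-pair : (g : Fin n → Fin n → ℕ) → (∀ u w → g u w ≡ g w u) →
                  ∀ u w → edgeTerm g u w + edgeTerm g w u ≡ (if adj G u w then g u w else 0)
  edgeTerm-pair g g-sym u w =
    trans (cong (λ b → edgeTerm g u w + (if b then (if toℕ w <ᵇ toℕ u then g w u else 0) else 0)) (Graph.sym G w u))
          (pair (adj G u w) refl)
    where
    loopless : adj G u w ≡ true → u ≢ w
    loopless u~w refl = case trans (sym u~w) (irrefl G u) of λ ()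
    pair : ∀ b → adj G u w ≡ b →
           (if b then (if toℕ u <ᵇ toℕ w then g u w else 0) else 0)
             + (if b then (if toℕ w <ᵇ toℕ u then g w u else 0) else 0)
           ≡ (if b then g u w else 0)
    pair false _    = refl
    pair true  u~w with <ᵇ-trichotomy (toℕ u) (toℕ w) (loopless u~w ∘ toℕ-injective)
    ... | inj₁ (u<w , w≮u) rewrite u<w | w≮u = +-identityʳ (g u w)
    ... | inj₂ (u≮w , w<u) rewrite u≮w | w<u = sym (g-sym u w)

  -- Every edge meets C at most once, so it is counted either by the first sum (no end in C)
  -- or exactly once by the second (from its end in C).
  edgeSum-split : (C : Fin n → Bool) → (∀ {u w} → C u ≡ true → C w ≡ true → adj G u w ≡ false) →
                  (g : Fin n → Fin n → ℕ) → (∀ u w → g u w ≡ g w u) →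
                  edgeSum g ≡ edgeSum (λ u w → if C u ∨ C w then 0 else g u w) + sumWhere C (λ u → sumWhere (adj G u) (g u))
  edgeSum-split C C-independent g g-sym = begin
    edgeSum g
      ≡⟨ sum-cong-≗ (λ u → sum-cong-≗ (λ w → split u w)) ⟩
    sum (λ u → sum (λ w → edgeTerm g₀ u w + (atᵘ u w + atʷ u w)))
      ≡⟨ sum-cong-≗ (λ u → trans (∑-distrib-+ (edgeTerm g₀ u) _)
                                  (cong (sum (edgeTerm g₀ u) +_) (∑-distrib-+ (atᵘ u) (atʷ u)))) ⟩
    sum (λ u → sum (edgeTerm g₀ u) + (sum (atᵘ u) + sum (atʷ u)))
      ≡⟨ trans (∑-distrib-+ (λ u → sum (edgeTerm g₀ u)) _)
               (cong (edgeSum g₀ +_) (∑-distrib-+ (λ u → sum (atᵘ u)) _)) ⟩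
    edgeSum g₀ + (sum (λ u → sum (atᵘ u)) + sum (λ u → sum (atʷ u)))
      ≡⟨ cong (λ s → edgeSum g₀ + (sum (λ u → sum (atᵘ u)) + s)) (∑-comm atʷ) ⟩
    edgeSum g₀ + (sum (λ u → sum (atᵘ u)) + sum (λ u → sum (λ w → atʷ w u)))
      ≡⟨ cong (edgeSum g₀ +_) (∑-distrib-+ (λ u → sum (atᵘ u)) _) ⟨
    edgeSum g₀ + sum (λ u → sum (atᵘ u) + sum (λ w → atʷ w u))
      ≡⟨ cong (edgeSum g₀ +_) (sum-cong-≗ (λ u → sym (∑-distrib-+ (atᵘ u) (λ w → atʷ w u)))) ⟩
    edgeSum g₀ + sum (λ u → sum (λ w → atᵘ u w + atʷ w u))
      ≡⟨ cong (edgeSum g₀ +_) (sum-cong-≗ (λ u →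
           trans (sum-cong-≗ (merge u)) (sum-if (C u) (λ w → if adj G u w then g u w else 0)))) ⟩
    edgeSum g₀ + sumWhere C (λ u → sumWhere (adj G u) (g u))
      ∎
    where
    open ≡-Reasoning
    g₀ : Fin n → Fin n → ℕ
    g₀ u w = if C u ∨ C w then 0 else g u w
    atᵘ atʷ : Fin n → Fin n → ℕ
    atᵘ u w = if C u then edgeTerm g u w else 0
    atʷ u w = if C w then edgeTerm g u w else 0

    edge-0 : ∀ a lt → (if a then (if lt then 0 else 0) else 0) ≡ 0
    edge-0 false _     = refl
    edge-0 true  false = refl
    edge-0 true  true  = refl

    split : ∀ u w → edgeTerm g u w ≡ edgeTerm g₀ u w + (atᵘ u w + atʷ u w)
    split u w = cases (C u) (C w) refl refl
      where
      e = edgeTerm g u w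
      cases : ∀ cu cw → C u ≡ cu → C w ≡ cw →
              e ≡ (if adj G u w then (if toℕ u <ᵇ toℕ w then (if cu ∨ cw then 0 else g u w) else 0) else 0)
                  + ((if cu then e else 0) + (if cw then e else 0))
      cases true  true  Cu Cw rewrite C-independent Cu Cw = refl
      cases true  false _  _  rewrite edge-0 (adj G u w) (toℕ u <ᵇ toℕ w) = sym (+-identityʳ e)
      cases false true  _  _  rewrite edge-0 (adj G u w) (toℕ u <ᵇ toℕ w) = refl
      cases false false _  _  = sym (+-identityʳ e)

    merge : ∀ u w → atᵘ u w + atʷ w u ≡ (if C u then (if adj G u w then g u w else 0) else 0)
    merge u w with C u
    ... | true  = edgeTerm-pair g g-sym u w
    ... | false = refl

-- Colour-preserving embeddings

module ColourEmbedding {K : Set} (_≟ₖ_ : DecidableEquality K) where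

  fibre : ∀ {n} → (Fin n → K) → K → Fin n → Bool
  fibre c k x = does (c x ≟ₖ k)

  record Embedding {n m} (cX : Fin n → K) (cY : Fin m → K) (Y : Fin m → Bool) : Set where
    field
      φ           : Fin n → Fin m
      φ-injective : ∀ {x x′} → φ x ≡ φ x′ → x ≡ x′
      φ-into      : ∀ x → Y (φ x) ≡ true
      φ-colour    : ∀ x → cY (φ x) ≡ cX x
      φ-transfer  : ∀ k → count (fibre cX k) ≡ count (Y ∩ fibre cY k) →
                    ∀ h → sumWhere (fibre cX k) (h ∘ φ) ≡ sumWhere (Y ∩ fibre cY k) h

  embed : ∀ {n m} (cX : Fin n → K) (cY : Fin m → K) (Y : Fin m → Bool) →
          (∀ k → count (fibre cX k) ≤ count (Y ∩ fibre cY k)) → Embedding cX cY Y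
  embed {zero} cX cY Y _ = record
    { φ = λ () ; φ-injective = λ { {()} } ; φ-into = λ () ; φ-colour = λ ()
    ; φ-transfer = λ k 0≡count h → sym (sumWhere-none (count-zero (sym 0≡count)) h)
    }
  embed {suc n} cX cY Y fits = record
    { φ           = y₀ ∷ φ′
    ; φ-injective = injective
    ; φ-into      = λ { zero → Yy₀ ; (suc x) → ∧-conicalˡ _ _ (φ′-into x) }
    ; φ-colour    = λ { zero → cYy₀≡k₀ ; (suc x) → φ′-colour x }
    ; φ-transfer  = transfer
    }
    where
    k₀ = cX zero
    y₀-spec : ∃ λ y → (Y ∩ fibre cY k₀) y ≡ true
    y₀-spec = count-witness (≤-trans (count-pos {P = fibre cX k₀} {zero} (dec-true (k₀ ≟ₖ k₀) refl)) (fits k₀))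
    y₀ = proj₁ y₀-spec
    Yy₀ : Y y₀ ≡ true
    Yy₀ = ∧-conicalˡ _ _ (proj₂ y₀-spec)
    cYy₀≡k₀ : cY y₀ ≡ k₀
    cYy₀≡k₀ = does-true (cY y₀ ≟ₖ k₀) (∧-conicalʳ (Y y₀) _ (proj₂ y₀-spec))

    Y′ : Fin _ → Bool
    Y′ = Y ∩ ∁ ⁅ y₀ ⁆

    remove-y₀ : ∀ k h → sumWhere (Y ∩ fibre cY k) h ≡ (if fibre cX k zero then h y₀ else 0) + sumWhere (Y′ ∩ fibre cY k) h
    remove-y₀ k h = begin
      sumWhere (Y ∩ fibre cY k) h
        ≡⟨ sumWhere-pick (Y ∩ fibre cY k) y₀ h ⟩
      (if Y y₀ ∧ fibre cY k y₀ then h y₀ else 0) + sumWhere ((Y ∩ fibre cY k) ∩ ∁ ⁅ y₀ ⁆) h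
        ≡⟨ cong₂ (λ b c → (if b ∧ does (c ≟ₖ k) then h y₀ else 0) + sumWhere ((Y ∩ fibre cY k) ∩ ∁ ⁅ y₀ ⁆) h)
                 Yy₀ cYy₀≡k₀ ⟩
      (if fibre cX k zero then h y₀ else 0) + sumWhere ((Y ∩ fibre cY k) ∩ ∁ ⁅ y₀ ⁆) h
        ≡⟨ cong ((if fibre cX k zero then h y₀ else 0) +_) (sumWhere-cong (λ y → xy∙z≈xz∙y (Y y) _ _) h) ⟩
      (if fibre cX k zero then h y₀ else 0) + sumWhere (Y′ ∩ fibre cY k) h
        ∎
      where open ≡-Reasoning

    fits′ : ∀ k → count (fibre (cX ∘ suc) k) ≤ count (Y′ ∩ fibre cY k)
    fits′ k = +-cancelˡ-≤ (𝟙 (fibre cX k zero)) _ _ (≤-trans (fits k) (≤-reflexive (remove-y₀ k (const 1))))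

    open Embedding (embed (cX ∘ suc) cY Y′ fits′) renaming
      (φ to φ′; φ-injective to φ′-injective; φ-into to φ′-into; φ-colour to φ′-colour; φ-transfer to φ′-transfer)

    φ′≢y₀ : ∀ x → φ′ x ≢ y₀
    φ′≢y₀ x φ′x≡y₀ = case trans (cong not (sym (dec-true (y₀ ≟ᶠ y₀) refl))) y₀∉⁅y₀⁆ of λ ()
      where
      y₀∉⁅y₀⁆ : not (⁅ y₀ ⁆ y₀) ≡ true
      y₀∉⁅y₀⁆ = subst (λ y → not (⁅ y₀ ⁆ y) ≡ true) φ′x≡y₀ (∧-conicalʳ (Y (φ′ x)) _ (φ′-into x))

    injective : ∀ {x x′} → (y₀ ∷ φ′) x ≡ (y₀ ∷ φ′) x′ → x ≡ x′
    injective {zero}  {zero}   _  = refl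
    injective {zero}  {suc x′} eq = ⊥-elim (φ′≢y₀ x′ (sym eq))
    injective {suc x} {zero}   eq = ⊥-elim (φ′≢y₀ x eq)
    injective {suc x} {suc x′} eq = cong suc (φ′-injective eq)

    transfer : ∀ k → count (fibre cX k) ≡ count (Y ∩ fibre cY k) →
               ∀ h → sumWhere (fibre cX k) (h ∘ (y₀ ∷ φ′)) ≡ sumWhere (Y ∩ fibre cY k) h
    transfer k eq h = trans (cong ((if fibre cX k zero then h y₀ else 0) +_) (φ′-transfer k eq′ h)) (sym (remove-y₀ k h))
      where
      eq′ : count (fibre (cX ∘ suc) k) ≡ count (Y′ ∩ fibre cY k)
      eq′ = +-cancelˡ-≡ (𝟙 (fibre cX k zero)) _ _ (trans eq (remove-y₀ k (const 1)))

data Role (l : ℕ) : Set where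
  centre leaf : Fin l → Role l
  other       : Role l

_≟ʳ_ : ∀ {l} → DecidableEquality (Role l)
centre i ≟ʳ centre j = map′ (cong centre) (λ { refl → refl }) (i ≟ᶠ j)
leaf i   ≟ʳ leaf j   = map′ (cong leaf) (λ { refl → refl }) (i ≟ᶠ j)
other    ≟ʳ other    = yes refl
centre _ ≟ʳ leaf _   = no (λ ())
centre _ ≟ʳ other    = no (λ ())
leaf _   ≟ʳ centre _ = no (λ ())
leaf _   ≟ʳ other    = no (λ ())
other    ≟ʳ centre _ = no (λ ())
other    ≟ʳ leaf _   = no (λ ())

isCentre : ∀ {l} → Role l → Bool
isCentre (centre _) = true
isCentre _          = false

isCentre-view : ∀ {l} (r : Role l) → (∃ λ i → r ≡ centre i) ⊎ isCentre r ≡ false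
isCentre-view (centre i) = inj₁ (i , refl)
isCentre-view (leaf _)   = inj₂ refl
isCentre-view other      = inj₂ refl

module RoleEmbedding {l : ℕ} = ColourEmbedding (_≟ʳ_ {l})
open RoleEmbedding

count-role-fibres : ∀ {l} (r : Role l) →
  1 ≡ 𝟙 (does (r ≟ʳ other)) + (count (λ i → does (r ≟ʳ centre i)) + count (λ i → does (r ≟ʳ leaf i)))
count-role-fibres {l} r = sym (one-fibre r)
  where
  exactly-once : ∀ j → count (λ i → does (j ≟ᶠ i)) ≡ 1
  exactly-once j = count-single j (dec-true (j ≟ᶠ j) refl) (sym ∘ does-true (j ≟ᶠ _))
  never : count {l} (const false) ≡ 0
  never = count-none {l} {const false} (λ _ → refl)
  one-fibre : ∀ r → 𝟙 (does (r ≟ʳ other)) + (count (λ i → does (r ≟ʳ centre i)) + count (λ i → does (r ≟ʳ leaf i))) ≡ 1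
  one-fibre (centre j) = cong₂ _+_ (exactly-once j) never
  one-fibre (leaf j)   = cong₂ _+_ never (exactly-once j)
  one-fibre other      = cong (1 +_) (cong₂ _+_ never never)

module Roles {l N : ℕ} (C L : Fin l → Fin N → Bool)
  (C-disjoint   : ∀ {i j x} → C i x ≡ true → C j x ≡ true → i ≡ j)
  (L-disjoint   : ∀ {i j x} → L i x ≡ true → L j x ≡ true → i ≡ j)
  (C-L-disjoint : ∀ {i j x} → C i x ≡ true → L j x ≡ true → ⊥) where

  role : Fin N → Role l
  role x with any? (λ i → C i x ≟ᵇ true) | any? (λ i → L i x ≟ᵇ true)
  ... | yes (i , _) | _           = centre i
  ... | no _        | yes (i , _) = leaf i
  ... | no _        | no _        = other

  role-centre : ∀ {i x} → C i x ≡ true → role x ≡ centre i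
  role-centre {i} {x} Cix with any? (λ i → C i x ≟ᵇ true) | any? (λ i → L i x ≟ᵇ true)
  ... | yes (j , Cjx) | _ = cong centre (C-disjoint Cjx Cix)
  ... | no ¬C         | _ = ⊥-elim (¬C (i , Cix))

  role-leaf : ∀ {i x} → L i x ≡ true → role x ≡ leaf i
  role-leaf {i} {x} Lix with any? (λ i → C i x ≟ᵇ true) | any? (λ i → L i x ≟ᵇ true)
  ... | yes (j , Cjx) | _             = ⊥-elim (C-L-disjoint Cjx Lix)
  ... | no _          | yes (j , Ljx) = cong leaf (L-disjoint Ljx Lix)
  ... | no _          | no ¬L         = ⊥-elim (¬L (i , Lix))

  centre-role : ∀ {i x} → role x ≡ centre i → C i x ≡ true
  centre-role {i} {x} with any? (λ i → C i x ≟ᵇ true) | any? (λ i → L i x ≟ᵇ true)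
  ... | yes (j , Cjx) | _     = λ { refl → Cjx }
  ... | no _          | yes _ = λ ()
  ... | no _          | no _  = λ ()

  leaf-role : ∀ {i x} → role x ≡ leaf i → L i x ≡ true
  leaf-role {i} {x} with any? (λ i → C i x ≟ᵇ true) | any? (λ i → L i x ≟ᵇ true)
  ... | yes _ | _             = λ ()
  ... | no _  | yes (j , Ljx) = λ { refl → Ljx }
  ... | no _  | no _          = λ ()

  fibre-centre : ∀ i x → fibre role (centre i) x ≡ C i x
  fibre-centre i x = does-≡ (role x ≟ʳ centre i) centre-role role-centre

  fibre-leaf : ∀ i x → fibre role (leaf i) x ≡ L i x
  fibre-leaf i x = does-≡ (role x ≟ʳ leaf i) leaf-role role-leaf

  count-roles : N ≡ count (fibre role other) + (sum (λ i → count (C i)) + sum (λ i → count (L i)))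
  count-roles = begin
    N                                                        ≡⟨ count-all {N} {const true} (λ _ → refl) ⟨
    count {N} (const true)                                   ≡⟨ sum-cong-≗ one-role ⟩
    sum (λ x → 𝟙 (fibre role other x) + (sum (λ i → 𝟙 (C i x)) + sum (λ i → 𝟙 (L i x))))
      ≡⟨ ∑-distrib-+ (𝟙 ∘ fibre role other) _ ⟩
    count (fibre role other) + sum (λ x → sum (λ i → 𝟙 (C i x)) + sum (λ i → 𝟙 (L i x)))
      ≡⟨ cong (count (fibre role other) +_) (∑-distrib-+ (λ x → sum (λ i → 𝟙 (C i x))) _) ⟩
    count (fibre role other) + (sum (λ x → sum (λ i → 𝟙 (C i x))) + sum (λ x → sum (λ i → 𝟙 (L i x))))
      ≡⟨ cong (count (fibre role other) +_) (cong₂ _+_ (∑-comm (λ x i → 𝟙 (C i x))) (∑-comm (λ x i → 𝟙 (L i x)))) ⟩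
    count (fibre role other) + (sum (λ i → count (C i)) + sum (λ i → count (L i)))
      ∎
    where
    open ≡-Reasoning
    one-role : ∀ x → 1 ≡ 𝟙 (fibre role other x) + (sum (λ i → 𝟙 (C i x)) + sum (λ i → 𝟙 (L i x)))
    one-role x = trans (count-role-fibres (role x))
      (cong (𝟙 (fibre role other x) +_) (cong₂ _+_ (sum-cong-≗ (λ i → cong 𝟙 (fibre-centre i x)))
                                                   (sum-cong-≗ (λ i → cong 𝟙 (fibre-leaf i x)))))

module PackingRoles {l} (G : Graph n) (v : Fin l → Fin n) (packing : Is2Packing G v) where

  v-injective : ∀ {i j} → v i ≡ v j → i ≡ j
  v-injective = proj₁ packing _ _

  private
    separated : ∀ {i j w} → w ∈N[ v i ] G → w ∈N[ v j ] G → i ≡ j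
    separated {i} {j} {w} w∈Ni w∈Nj = decidable-stable (i ≟ᶠ j) (λ i≢j → proj₂ packing i j i≢j w (w∈Ni , w∈Nj))

    centres-disjoint : ∀ {i j u} → ⁅ v i ⁆ u ≡ true → ⁅ v j ⁆ u ≡ true → i ≡ j
    centres-disjoint {u = u} u≡vi u≡vj = separated (inj₁ (⁅⁆-elim {i = u} u≡vi)) (inj₁ (⁅⁆-elim {i = u} u≡vj))

    leaves-disjoint : ∀ {i j u} → adj G (v i) u ≡ true → adj G (v j) u ≡ true → i ≡ j
    leaves-disjoint vi~u vj~u = separated (inj₂ vi~u) (inj₂ vj~u)

    centre-not-leaf : ∀ {i j u} → ⁅ v i ⁆ u ≡ true → adj G (v j) u ≡ true → ⊥
    centre-not-leaf {i} {j} {u} u≡vi vj~u with separated {i} {j} (inj₁ (⁅⁆-elim u≡vi)) (inj₂ vj~u)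
    ... | refl = case trans (sym vj~u) (trans (cong (adj G (v i)) (⁅⁆-elim u≡vi)) (irrefl G (v i))) of λ ()

  open Roles (λ i → ⁅ v i ⁆) (λ i → adj G (v i)) (λ {i} {j} {u} → centres-disjoint {i} {j} {u})
             leaves-disjoint centre-not-leaf public

  role-v : ∀ i → role (v i) ≡ centre i
  role-v i = role-centre (dec-true (v i ≟ᶠ v i) refl)

  centre-is-v : ∀ {i u} → role u ≡ centre i → u ≡ v i
  centre-is-v = ⁅⁆-elim ∘ centre-role

  centres-independent : ∀ {u w} → isCentre (role u) ≡ true → isCentre (role w) ≡ true → adj G u w ≡ false
  centres-independent {u} {w} cu cw with isCentre-view (role u) | isCentre-view (role w)
  ... | inj₁ (i , ru) | inj₁ (j , rw) = ¬-not (λ u~w → centre-not-leaf {j} {i} (dec-true (w ≟ᶠ v j) (centre-is-v rw))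
                                                   (subst (λ x → adj G x w ≡ true) (centre-is-v ru) u~w))
  ... | inj₂ ¬cu | _ = case trans (sym cu) ¬cu of λ ()
  ... | _ | inj₂ ¬cw = case trans (sym cw) ¬cw of λ ()

module SwitchRoles {l m} (S T : Fin l → Subset m)
  (S-T-disjoint : ∀ i → Disjoint (S i) (T i))
  (disjoint : ∀ i j → i ≢ j → DisjointSwitches (S i) (T i) (S j) (T j)) where

  private
    same-switch : {i j : Fin l} → ¬ ¬ (i ≡ j) → i ≡ j
    same-switch {i} {j} = decidable-stable (i ≟ᶠ j)

    S-disjoint : ∀ {i j y} → lookup (S i) y ≡ true → lookup (S j) y ≡ true → i ≡ j
    S-disjoint {i} {j} {y} y∈Si y∈Sj = same-switch (λ i≢j →
      proj₁ (proj₂ (disjoint i j i≢j)) y (lookup⇒[]= y (S i) y∈Si) (lookup⇒[]= y (S j) y∈Sj))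

    T-disjoint : ∀ {i j y} → lookup (T i) y ≡ true → lookup (T j) y ≡ true → i ≡ j
    T-disjoint {i} {j} {y} y∈Ti y∈Tj = same-switch (λ i≢j →
      proj₁ (proj₂ (proj₂ (proj₂ (proj₂ (disjoint i j i≢j))))) y (lookup⇒[]= y (T i) y∈Ti) (lookup⇒[]= y (T j) y∈Tj))

    S-T-disjoint′ : ∀ {i j y} → lookup (S i) y ≡ true → lookup (T j) y ≡ true → ⊥
    S-T-disjoint′ {i} {j} {y} y∈Si y∈Tj with i ≟ᶠ j
    ... | yes refl = S-T-disjoint i y (lookup⇒[]= y (S i) y∈Si) (lookup⇒[]= y (T i) y∈Tj)
    ... | no  i≢j  = proj₁ (proj₂ (proj₂ (disjoint i j i≢j))) y (lookup⇒[]= y (S i) y∈Si) (lookup⇒[]= y (T j) y∈Tj)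

  open Roles (λ i → lookup (S i)) (λ i → lookup (T i)) S-disjoint T-disjoint S-T-disjoint′ public

module StarDecomposition {l p : ℕ} .{{_ : NonZero p}}
  (G : Graph n) (v : Fin l → Fin n) (packing : Is2Packing G v)
  (f : Labelling (n + p ∸ 1) p) (f-sym : Symmetric f)
  (S T : Fin l → Subset (n + p ∸ 1))
  (S-T-disjoint : ∀ i → Disjoint (S i) (T i))
  (disjoint : ∀ i j → i ≢ j → DisjointSwitches (S i) (T i) (S j) (T j))
  (S-nonempty : ∀ i → 1 ≤ ∣ S i ∣)
  (T≡deg : ∀ i → ∣ T i ∣ ≡ deg G (v i))
  (ΣS≤ : sum (λ i → ∣ S i ∣) ≤ p + l ∸ 1) where

  open Residues p using (%-sum)

  private
    m = n + p ∸ 1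
    module RG = PackingRoles G v packing
    module RH = SwitchRoles S T S-T-disjoint disjoint

  count-leaves : ∀ i → count (fibre RG.role (leaf i)) ≡ count (fibre RH.role (leaf i))
  count-leaves i = begin
    count (fibre RG.role (leaf i))   ≡⟨ sum-cong-≗ (cong 𝟙 ∘ RG.fibre-leaf i) ⟩
    count (adj G (v i))              ≡⟨ Σ[<]≡sum (𝟙 ∘ adj G (v i)) ⟨
    deg G (v i)                      ≡⟨ T≡deg i ⟨
    ∣ T i ∣                          ≡⟨ count-lookup (T i) ⟨
    count (lookup (T i))             ≡⟨ sum-cong-≗ (cong 𝟙 ∘ RH.fibre-leaf i) ⟨
    count (fibre RH.role (leaf i))   ∎
    where open ≡-Reasoning

  count-others-≤ : count (fibre RG.role other) ≤ count (fibre RH.role other)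
  count-others-≤ = +-cancelʳ-≤ X oG oH (begin
    oG + X                          ≡⟨ +-assoc oG (l + D) (p ∸ 1) ⟨
    oG + (l + D) + (p ∸ 1)          ≡⟨ cong (λ k → oG + (k + D) + (p ∸ 1)) centres≡l ⟨
    oG + (ΣC + D) + (p ∸ 1)         ≡⟨ cong (_+ (p ∸ 1)) RG.count-roles ⟨
    n + (p ∸ 1)                     ≡⟨ +-∸-assoc n (>-nonZero⁻¹ p) ⟨
    m                               ≡⟨ RH.count-roles ⟩
    oH + (ΣS + D′)                  ≡⟨ cong₂ (λ a b → oH + (a + b)) (sum-cong-≗ (count-lookup ∘ S)) leaves≡ ⟩
    oH + (sum (λ i → ∣ S i ∣) + D)  ≤⟨ +-monoʳ-≤ oH (+-monoˡ-≤ D ΣS≤p-1+l) ⟩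
    oH + ((p ∸ 1 + l) + D)          ≡⟨ cong (oH +_) (rearrange (p ∸ 1) l D) ⟩
    oH + X                          ∎)
    where
    open ≤-Reasoning
    oG = count (fibre RG.role other)
    oH = count (fibre RH.role other)
    ΣC = sum (λ i → count (⁅ v i ⁆))
    ΣS = sum (λ i → count (lookup (S i)))
    D  = sum (λ i → count (adj G (v i)))
    D′ = sum (λ i → count (lookup (T i)))
    X  = (l + D) + (p ∸ 1)
    centres≡l : ΣC ≡ l
    centres≡l = trans (sum-cong-≗ (count-⁅⁆ ∘ v)) (count-all {l} {const true} (λ _ → refl))
    leaves≡ : D′ ≡ D
    leaves≡ = sum-cong-≗ (λ i → trans (sym (sum-cong-≗ (cong 𝟙 ∘ RH.fibre-leaf i)))
                            (trans (sym (count-leaves i)) (sum-cong-≗ (cong 𝟙 ∘ RG.fibre-leaf i))))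
    ΣS≤p-1+l : sum (λ i → ∣ S i ∣) ≤ p ∸ 1 + l
    ΣS≤p-1+l = ≤-trans ΣS≤ (≤-reflexive (+-∸-comm l (>-nonZero⁻¹ p)))
    rearrange : ∀ a b c → (a + b) + c ≡ (b + c) + a
    rearrange = solve-∀

  fits : ∀ r → count (fibre RG.role r) ≤ count (fibre RH.role r)
  fits (centre i) = begin
    count (fibre RG.role (centre i))  ≡⟨ sum-cong-≗ (cong 𝟙 ∘ RG.fibre-centre i) ⟩
    count ⁅ v i ⁆                     ≡⟨ count-⁅⁆ (v i) ⟩
    1                                 ≤⟨ S-nonempty i ⟩
    ∣ S i ∣                           ≡⟨ count-lookup (S i) ⟨
    count (lookup (S i))              ≡⟨ sum-cong-≗ (cong 𝟙 ∘ RH.fibre-centre i) ⟨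
    count (fibre RH.role (centre i))  ∎
    where open ≤-Reasoning
  fits (leaf i) = ≤-reflexive (count-leaves i)
  fits other    = count-others-≤

  open Embedding (embed RG.role RH.role (const true) fits)

  centre? : Fin n → Bool
  centre? = isCentre ∘ RG.role

  C₀ : ℕ
  C₀ = edgeSum G (λ u w → if centre? u ∨ centre? w then 0 else toℕ (f (φ u) (φ w)))

  module Placement (s : Fin l → Fin m) (s∈S : ∀ i → lookup (S i) (s i) ≡ true) where

    relocate : Role l → Fin m → Fin m
    relocate (centre i) _ = s i
    relocate _          y = y

    place : Fin n → Fin m
    place u = relocate (RG.role u) (φ u)

    place-role : ∀ u → RH.role (place u) ≡ RG.role u
    place-role u = relocate-role (RG.role u) (φ-colour u)
      where
      relocate-role : ∀ r {y} → RH.role y ≡ r → RH.role (relocate r y) ≡ r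
      relocate-role (centre i) _  = RH.role-centre (s∈S i)
      relocate-role (leaf _)   eq = eq
      relocate-role other      eq = eq

    place-off-centre : ∀ {u} → centre? u ≡ false → place u ≡ φ u
    place-off-centre {u} = relocate-off (RG.role u)
      where
      relocate-off : ∀ r {y} → isCentre r ≡ false → relocate r y ≡ y
      relocate-off (centre _) ()
      relocate-off (leaf _)   _ = refl
      relocate-off other      _ = refl

    place-v : ∀ i → place (v i) ≡ s i
    place-v i = cong (λ r → relocate r (φ (v i))) (RG.role-v i)

    place-injective : ∀ {u w} → place u ≡ place w → u ≡ w
    place-injective {u} {w} eq = case isCentre-view (RG.role u) of λ where
        (inj₁ (i , ru)) → trans (RG.centre-is-v ru) (sym (RG.centre-is-v (trans (sym same-role) ru)))
        (inj₂ ¬cu)      → φ-injective (trans (sym (place-off-centre ¬cu))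
                                      (trans eq (place-off-centre (trans (cong isCentre (sym same-role)) ¬cu))))
      where
      same-role : RG.role u ≡ RG.role w
      same-role = trans (sym (place-role u)) (trans (cong RH.role eq) (place-role w))

    star : Fin l → ℕ
    star i = Σ[< m ] (λ t → if lookup (T i) t then toℕ (f (s i) t) else 0)

    star-at-centre : ∀ i → sumWhere (adj G (v i)) (λ w → toℕ (f (place (v i)) (place w))) ≡ star i
    star-at-centre i = begin
      sumWhere (adj G (v i)) (λ w → toℕ (f (place (v i)) (place w)))
        ≡⟨ sum-cong-≗ (λ w → leaf-term w (adj G (v i) w) refl) ⟩
      sumWhere (adj G (v i)) (λ w → toℕ (f (s i) (φ w)))
        ≡⟨ sumWhere-cong (sym ∘ RG.fibre-leaf i) _ ⟩
      sumWhere (fibre RG.role (leaf i)) (λ w → toℕ (f (s i) (φ w)))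
        ≡⟨ φ-transfer (leaf i) (count-leaves i) (λ y → toℕ (f (s i) y)) ⟩
      sumWhere (fibre RH.role (leaf i)) (λ y → toℕ (f (s i) y))
        ≡⟨ sumWhere-cong (RH.fibre-leaf i) _ ⟩
      sumWhere (lookup (T i)) (λ y → toℕ (f (s i) y))
        ≡⟨ Σ[<]≡sum (λ t → if lookup (T i) t then toℕ (f (s i) t) else 0) ⟨
      star i
        ∎
      where
      open ≡-Reasoning
      leaf-term : ∀ w b → adj G (v i) w ≡ b →
                  (if b then toℕ (f (place (v i)) (place w)) else 0) ≡ (if b then toℕ (f (s i) (φ w)) else 0)
      leaf-term w false _   = refl
      leaf-term w true  v~w = cong₂ (λ x y → toℕ (f x y)) (place-v i) (place-off-centre (cong isCentre (RG.role-leaf v~w)))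

    copySum-place : copySum G f place ≡ (C₀ + sum (λ i → starSum f (s i) (T i))) % p
    copySum-place = begin
      copySum G f place
        ≡⟨ copySum≡edgeSum G f place ⟩
      edgeSum G g % p
        ≡⟨ cong (_% p) (edgeSum-split G centre? RG.centres-independent g (λ u w → cong toℕ (f-sym (place u) (place w)))) ⟩
      (edgeSum G (λ u w → if centre? u ∨ centre? w then 0 else g u w) + sumWhere centre? (λ u → sumWhere (adj G u) (g u))) % p
        ≡⟨ cong₂ (λ a b → (a + b) % p) (sum-cong-≗ (λ u → sum-cong-≗ (λ w →
             cong (λ k → if adj G u w then (if toℕ u <ᵇ toℕ w then k else 0) else 0) (masked-agree u w))))
             (sumWhere-image v RG.v-injective centre-is-v centre-v _) ⟩
      (C₀ + sum (λ i → sumWhere (adj G (v i)) (g (v i)))) % p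
        ≡⟨ cong (λ a → (C₀ + a) % p) (sum-cong-≗ star-at-centre) ⟩
      (C₀ + sum star) % p
        ≡⟨ %-sum C₀ star ⟩
      (C₀ + sum (λ i → starSum f (s i) (T i))) % p
        ∎
      where
      open ≡-Reasoning
      g : Fin n → Fin n → ℕ
      g u w = toℕ (f (place u) (place w))
      centre-is-v : ∀ {u} → centre? u ≡ true → ∃ λ i → v i ≡ u
      centre-is-v {u} cu = case isCentre-view (RG.role u) of λ where
        (inj₁ (i , ru)) → i , sym (RG.centre-is-v ru)
        (inj₂ ¬cu)      → case trans (sym cu) ¬cu of λ ()
      centre-v : ∀ i → centre? (v i) ≡ true
      centre-v i = cong isCentre (RG.role-v i)
      masked-agree : ∀ u w → (if centre? u ∨ centre? w then 0 else g u w)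
                             ≡ (if centre? u ∨ centre? w then 0 else toℕ (f (φ u) (φ w)))
      masked-agree u w = agree (centre? u) (centre? w) refl refl
        where
        agree : ∀ a b → centre? u ≡ a → centre? w ≡ b →
                (if a ∨ b then 0 else g u w) ≡ (if a ∨ b then 0 else toℕ (f (φ u) (φ w)))
        agree false false ¬cu ¬cw = cong₂ (λ x y → toℕ (f x y)) (place-off-centre ¬cu) (place-off-centre ¬cw)
        agree false true  _   _   = refl
        agree true  _     _   _   = refl

module _ {m p l : ℕ} .{{_ : NonZero p}} where

  open Residues p

  star-sums-cover : Prime p → (f : Labelling m p) (S T : Fin l → Subset m) →
    (∀ i → IsSwitch f (S i) (T i)) → p + l ∸ 1 ≤ sum (λ i → ∣ S i ∣) →
    ∀ z → ∃ λ s → (∀ i → lookup (S i) (s i) ≡ true) × [ sum (λ i → starSum f (s i) (T i)) ] ≡ z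
  star-sums-cover p-prime f S T switch ΣS≥ z =
    s , s∈S , trans (cong [_] (sum-cong-≗ (λ i → trans (sym (toℕ-σ i (s i))) (cong toℕ (σs≡c i)))))
                    (proj₂ (proj₂ covering))
    where
    σ : Fin l → Fin m → ℤₚ
    σ i y = [ Σ[< m ] (λ t → if lookup (T i) t then toℕ (f y t) else 0) ]

    toℕ-σ : ∀ i y → toℕ (σ i y) ≡ starSum f y (T i)
    toℕ-σ i y = toℕ-[] _

    σ-injective : ∀ i {y y′} → lookup (S i) y ≡ true → lookup (S i) y′ ≡ true → σ i y ≡ σ i y′ → y ≡ y′
    σ-injective i {y} {y′} y∈S y′∈S σy≡σy′ = decidable-stable (y ≟ᶠ y′) (λ y≢y′ →
      proj₂ (proj₂ (proj₂ (switch i))) y y′ (lookup⇒[]= y (S i) y∈S) (lookup⇒[]= y′ (S i) y′∈S) y≢y′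
        (trans (sym (toℕ-σ i y)) (trans (cong toℕ σy≡σy′) (toℕ-σ i y′))))

    A : Fin l → ℤₚ → Bool
    A i = image (lookup (S i)) (σ i)

    S≤A : ∀ i → ∣ S i ∣ ≤ count (A i)
    S≤A i = subst (_≤ count (A i)) (count-lookup (S i)) (count-image (lookup (S i)) (σ i) (σ-injective i))

    1≤S : ∀ i → 1 ≤ ∣ S i ∣
    1≤S i = ≤-trans (s≤s z≤n) (proj₁ (switch i))

    excess : p ∸ 1 ≤ sum (λ i → count (A i) ∸ 1)
    excess = +-cancelʳ-≤ l _ _ (begin
      p ∸ 1 + l                        ≡⟨ +-∸-comm l (>-nonZero⁻¹ p) ⟨
      p + l ∸ 1                        ≤⟨ ΣS≥ ⟩
      sum (λ i → ∣ S i ∣)               ≡⟨ sum-∸1 1≤S ⟨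
      sum (λ i → ∣ S i ∣ ∸ 1) + l       ≤⟨ +-monoˡ-≤ l (sum-mono-≤ (λ i → ∸-monoˡ-≤ 1 (S≤A i))) ⟩
      sum (λ i → count (A i) ∸ 1) + l  ∎)
      where open ≤-Reasoning

    covering = ⨁-elim A (⨁-full p-prime A (λ i → ≤-trans (1≤S i) (S≤A i)) excess z)
    c = proj₁ covering

    picked : ∀ i → ∃ λ y → lookup (S i) y ≡ true × σ i y ≡ c i
    picked i = image-elim (lookup (S i)) (σ i) (proj₁ (proj₂ covering) i)

    s : Fin l → Fin m
    s i = proj₁ (picked i)
    s∈S : ∀ i → lookup (S i) (s i) ≡ true
    s∈S i = proj₁ (proj₂ (picked i))
    σs≡c : ∀ i → σ i (s i) ≡ c i
    σs≡c i = proj₂ (proj₂ (picked i))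

lemma2p4 : (p : ℕ) → .{{_ : NonZero p}} → Prime p →
    (n l : ℕ) (G : Graph n) (v : Fin l → Fin n) → Is2Packing G v →
    (f : Labelling (n + p ∸ 1) p) → Symmetric f →
    (S T : Fin l → Subset (n + p ∸ 1)) →
    (∀ i → IsSwitch f (S i) (T i)) →
    (∀ i j → i ≢ j → DisjointSwitches (S i) (T i) (S j) (T j)) →
    (∀ i → ∣ T i ∣ ≡ deg G (v i)) →
    Σ[< l ] (λ i → ∣ S i ∣) ≡ p + l ∸ 1 →
    Σ (Fin n → Fin (n + p ∸ 1)) (λ φ →
      (∀ x y → φ x ≡ φ y → x ≡ y) × copySum G f φ ≡ 0)
lemma2p4 p p-prime n l G v packing f f-sym S T switch disjoint T≡deg ΣS≡ =
  place , (λ _ _ → place-injective) , (begin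
    copySum G f place                                      ≡⟨ copySum-place ⟩
    (C₀ + sum (λ i → starSum f (s i) (T i))) % p           ≡⟨ toℕ-[] _ ⟨
    toℕ [ C₀ + sum (λ i → starSum f (s i) (T i)) ]         ≡⟨ cong toℕ ([]-+ C₀ _) ⟩
    toℕ ([ C₀ ] ⊕ [ sum (λ i → starSum f (s i) (T i)) ])   ≡⟨ cong (λ x → toℕ ([ C₀ ] ⊕ x)) (proj₂ (proj₂ choice)) ⟩
    toℕ ([ C₀ ] ⊕ - [ C₀ ])                                ≡⟨ cong toℕ (⊕-inverseʳ [ C₀ ]) ⟩
    toℕ [ 0 ]                                              ≡⟨ toℕ-[0] ⟩
    0                                                      ∎)
  where
  open ≡-Reasoning
  open Residues p
  ΣS≡′ : sum (λ i → ∣ S i ∣) ≡ p + l ∸ 1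
  ΣS≡′ = trans (sym (Σ[<]≡sum (λ i → ∣ S i ∣))) ΣS≡
  open StarDecomposition G v packing f f-sym S T (λ i → proj₁ (proj₂ (proj₂ (switch i)))) disjoint
         (λ i → ≤-trans (s≤s z≤n) (proj₁ (switch i))) T≡deg (≤-reflexive ΣS≡′)
  choice = star-sums-cover p-prime f S T switch (≤-reflexive (sym ΣS≡′)) (- [ C₀ ])
  s = proj₁ choice
  open Placement s (proj₁ (proj₂ choice))
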